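{- For any graph $G$ on $n$ vertices, letting $x_e=\frac{\deg(u)+\deg(v)}{2}$ for each edge $e=uv$, we have $$\sum_{e\in E(G)} 2(n-x_e)\le n\left\lfloor\frac{n^2}{4}\right\rfloor.$$ -}

module Defs where

open import Data.Nat using (ℕ; _*_; _/_)
open import Data.Bool using (Bool; true; false; if_then_else_)
open import Data.Fin using (Fin; toℕ; _<?_)
open import Data.Integer using (ℤ; +_; _-_) renaming (_+_ to _+ℤ_; _*_ to _*ℤ_)
open import Relation.Nullary.Decidable using (⌊_⌋)
open import Relation.Binary.PropositionalEquality using (_≡_)

record Graph (n : ℕ) : Set where
  field
    adj   : Fin n → Fin n → Bool
    sym   : ∀ u v → adj u v ≡ adj v u
    irrefl : ∀ u → adj u u ≡ false

open Graph public

sumℕ : (n : ℕ) → (Fin n → ℕ) → ℕ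
sumℕ ℕ.zero f = 0
sumℕ (ℕ.suc n) f = f Fin.zero Data.Nat.+ sumℕ n (λ i → f (Fin.suc i))

sumℤ : (n : ℕ) → (Fin n → ℤ) → ℤ
sumℤ ℕ.zero f = + 0
sumℤ (ℕ.suc n) f = f Fin.zero +ℤ sumℤ n (λ i → f (Fin.suc i))

deg : ∀ {n} → Graph n → Fin n → ℕ
deg {n} G u = sumℕ n (λ v → if adj G u v then 1 else 0)

-- Σ_{e = uv ∈ E(G)} f u v : each edge counted once, via its ordered pair u < v.
edgeSumℤ : ∀ {n} → Graph n → (Fin n → Fin n → ℤ) → ℤ
edgeSumℤ {n} G f =
  sumℤ n (λ u → sumℤ n (λ v →
    if ⌊ u <? v ⌋ then (if adj G u v then f u v else + 0) else + 0))

-- 2 (n - x_e) with x_e = (deg u + deg v)/2, i.e. 2n - deg u - deg v (exact, in ℤ).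
twiceGap : ∀ {n} → Graph n → Fin n → Fin n → ℤ
twiceGap {n} G u v = + (2 * n) - (+ deg G u) - (+ deg G v)

module Submission where

-- Write d(u) for the degree of u.  Since 2(n - x_e) = (n - d u) + (n - d v)
-- for e = uv, the edge sum is a sum of vertex weights a(u) = n - d(u) over the endpoints of
-- the edges, and by double counting
--     Σ_{uv ∈ E} (a u + a v) = Σ_u a(u) · d(u) = Σ_u (n - d u) · d u .
-- Each summand satisfies (n - x) x ≤ ⌊n²/4⌋, because 4 (n - x) x + (n - 2x)² = n²;
-- summing over the n vertices gives the bound n ⌊n²/4⌋.

open import Defs
open import Data.Nat using (ℕ; _*_; _/_)
open import Data.Integer using (+_; _≤_)

import Data.Nat as ℕ
import Data.Nat.Properties as ℕP
import Data.Nat.DivMod as ℕD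
open import Data.Integer using (ℤ; +≤+; -≤+; -[1+_]; _-_) renaming (_+_ to _+ℤ_; _*_ to _*ℤ_)
import Data.Integer.Properties as ℤP
open import Data.Integer.Tactic.RingSolver using (solve-∀)
open import Data.Fin using (Fin; _<?_)
import Data.Fin.Properties as FinP
open import Data.Bool using (true; false; if_then_else_)
open import Relation.Nullary using (yes; no)
open import Relation.Nullary.Decidable using (⌊_⌋)
open import Relation.Binary.PropositionalEquality
  using (_≡_; refl; cong; cong₂; trans; subst; module ≡-Reasoning)
  renaming (sym to ≡-sym)
open import Data.Empty using (⊥-elim)

sum-cong : ∀ n {f g : Fin n → ℤ} → (∀ i → f i ≡ g i) → sumℤ n f ≡ sumℤ n g
sum-cong ℕ.zero    eq = refl
sum-cong (ℕ.suc n) eq = cong₂ _+ℤ_ (eq Fin.zero) (sum-cong n (λ i → eq (Fin.suc i)))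

sum-mono-≤ : ∀ n {f g : Fin n → ℤ} → (∀ i → f i ≤ g i) → sumℤ n f ≤ sumℤ n g
sum-mono-≤ ℕ.zero    le = +≤+ ℕ.z≤n
sum-mono-≤ (ℕ.suc n) le = ℤP.+-mono-≤ (le Fin.zero) (sum-mono-≤ n (λ i → le (Fin.suc i)))

sum-+ : ∀ n (f g : Fin n → ℤ) → sumℤ n (λ i → f i +ℤ g i) ≡ sumℤ n f +ℤ sumℤ n g
sum-+ ℕ.zero    f g = refl
sum-+ (ℕ.suc n) f g = trans
  (cong (f Fin.zero +ℤ g Fin.zero +ℤ_) (sum-+ n (λ i → f (Fin.suc i)) (λ i → g (Fin.suc i))))
  (interchange (f Fin.zero) (g Fin.zero) _ _)
  where
  interchange : ∀ a b c d → (a +ℤ b) +ℤ (c +ℤ d) ≡ (a +ℤ c) +ℤ (b +ℤ d)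
  interchange = solve-∀

sum-zero : ∀ n → sumℤ n (λ _ → + 0) ≡ + 0
sum-zero ℕ.zero    = refl
sum-zero (ℕ.suc n) = trans (ℤP.+-identityˡ _) (sum-zero n)

sum-*ˡ : ∀ n (c : ℤ) (f : Fin n → ℤ) → sumℤ n (λ i → c *ℤ f i) ≡ c *ℤ sumℤ n f
sum-*ˡ ℕ.zero    c f = ≡-sym (ℤP.*-zeroʳ c)
sum-*ˡ (ℕ.suc n) c f = trans
  (cong (c *ℤ f Fin.zero +ℤ_) (sum-*ˡ n c (λ i → f (Fin.suc i))))
  (≡-sym (ℤP.*-distribˡ-+ c (f Fin.zero) _))

sum-swap : ∀ n m (f : Fin n → Fin m → ℤ) →
  sumℤ n (λ u → sumℤ m (f u)) ≡ sumℤ m (λ v → sumℤ n (λ u → f u v))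
sum-swap ℕ.zero    m f = ≡-sym (sum-zero m)
sum-swap (ℕ.suc n) m f = trans
  (cong (sumℤ m (f Fin.zero) +ℤ_) (sum-swap n m (λ u → f (Fin.suc u))))
  (≡-sym (sum-+ m (f Fin.zero) _))

sum-pos : ∀ n (f : Fin n → ℕ) → sumℤ n (λ i → + f i) ≡ + sumℕ n f
sum-pos ℕ.zero    f = refl
sum-pos (ℕ.suc n) f = trans
  (cong (+ f Fin.zero +ℤ_) (sum-pos n (λ i → f (Fin.suc i))))
  (≡-sym (ℤP.pos-+ (f Fin.zero) _))

sumℕ-const : ∀ n k → sumℕ n (λ _ → k) ≡ n * k
sumℕ-const ℕ.zero    k = refl
sumℕ-const (ℕ.suc n) k = cong (k ℕ.+_) (sumℕ-const n k)

fullSum : ∀ n → (Fin n → Fin n → ℤ) → ℤ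
fullSum n f = sumℤ n (λ u → sumℤ n (f u))

fullSum-symmetrise : ∀ n (f g : Fin n → Fin n → ℤ) → (∀ u v → f u v ≡ g u v +ℤ g v u) →
  fullSum n f ≡ fullSum n g +ℤ fullSum n g
fullSum-symmetrise n f g split = begin
  sumℤ n (λ u → sumℤ n (f u))                             ≡⟨ sum-cong n (λ u → sum-cong n (split u)) ⟩
  sumℤ n (λ u → sumℤ n (λ v → g u v +ℤ g v u))            ≡⟨ sum-cong n (λ u → sum-+ n (g u) (λ v → g v u)) ⟩
  sumℤ n (λ u → sumℤ n (g u) +ℤ sumℤ n (λ v → g v u))     ≡⟨ sum-+ n _ _ ⟩
  fullSum n g +ℤ sumℤ n (λ u → sumℤ n (λ v → g v u))      ≡⟨ cong (fullSum n g +ℤ_) (≡-sym (sum-swap n n g)) ⟩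
  fullSum n g +ℤ fullSum n g                              ∎
  where open ≡-Reasoning

upper : ∀ {n} → (Fin n → Fin n → ℤ) → Fin n → Fin n → ℤ
upper f u v = if ⌊ u <? v ⌋ then f u v else + 0

upper-split : ∀ {n} (f : Fin n → Fin n → ℤ) →
  (∀ u v → f u v ≡ f v u) → (∀ u → f u u ≡ + 0) →
  ∀ u v → f u v ≡ upper f u v +ℤ upper f v u
upper-split f f-sym f-diag u v with u <? v | v <? u
... | yes u<v | yes v<u = ⊥-elim (FinP.<-asym u<v v<u)
... | yes _   | no  _   = ≡-sym (ℤP.+-identityʳ _)
... | no  _   | yes _   = trans (f-sym u v) (≡-sym (ℤP.+-identityˡ _))
... | no  u≮v | no  v≮u with FinP.≤-antisym (ℕP.≮⇒≥ v≮u) (ℕP.≮⇒≥ u≮v)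
...   | refl = f-diag u

fullSum≡2·upperSum : ∀ n (f : Fin n → Fin n → ℤ) →
  (∀ u v → f u v ≡ f v u) → (∀ u → f u u ≡ + 0) →
  fullSum n f ≡ fullSum n (upper f) +ℤ fullSum n (upper f)
fullSum≡2·upperSum n f f-sym f-diag =
  fullSum-symmetrise n f (upper f) (upper-split f f-sym f-diag)

+-double-injective : ∀ {x y : ℤ} → x +ℤ x ≡ y +ℤ y → x ≡ y
+-double-injective {x} {y} eq = ℤP.*-cancelˡ-≡ (+ 2) x y
  (trans (≡-sym (double x)) (trans eq (double y)))
  where
  double : ∀ z → z +ℤ z ≡ + 2 *ℤ z
  double = solve-∀

-- f restricted to the edges of G (as ordered pairs); by definition,
-- edgeSumℤ G f is the full sum of  upper (onEdges G f).
onEdges : ∀ {n} → Graph n → (Fin n → Fin n → ℤ) → Fin n → Fin n → ℤ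
onEdges G f u v = if adj G u v then f u v else + 0

edgeSum-cong : ∀ {n} (G : Graph n) {f g : Fin n → Fin n → ℤ} → (∀ u v → f u v ≡ g u v) →
  edgeSumℤ G f ≡ edgeSumℤ G g
edgeSum-cong {n} G eq = sum-cong n (λ u → sum-cong n (λ v →
  cong (λ z → if ⌊ u <? v ⌋ then (if adj G u v then z else + 0) else + 0) (eq u v)))

neighbourSum : ∀ {n} (G : Graph n) (c : ℤ) (u : Fin n) →
  sumℤ n (λ v → onEdges G (λ _ _ → c) u v) ≡ c *ℤ + deg G u
neighbourSum {n} G c u = begin
  sumℤ n (λ v → onEdges G (λ _ _ → c) u v)           ≡⟨ sum-cong n indicator ⟩
  sumℤ n (λ v → c *ℤ + (if adj G u v then 1 else 0))  ≡⟨ sum-*ˡ n c _ ⟩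
  c *ℤ sumℤ n (λ v → + (if adj G u v then 1 else 0))  ≡⟨ cong (c *ℤ_) (sum-pos n _) ⟩
  c *ℤ + deg G u                                      ∎
  where
  open ≡-Reasoning
  indicator : ∀ v → onEdges G (λ _ _ → c) u v ≡ c *ℤ + (if adj G u v then 1 else 0)
  indicator v with adj G u v
  ... | true  = ≡-sym (ℤP.*-identityʳ c)
  ... | false = ≡-sym (ℤP.*-zeroʳ c)

edgeSum-vertexWeights : ∀ {n} (G : Graph n) (a : Fin n → ℤ) →
  edgeSumℤ G (λ u v → a u +ℤ a v) ≡ sumℤ n (λ u → a u *ℤ + deg G u)
edgeSum-vertexWeights {n} G a = +-double-injective (begin
  E +ℤ E                     ≡⟨ ≡-sym (fullSum≡2·upperSum n edgeWeight edgeWeight-sym edgeWeight-diag) ⟩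
  fullSum n edgeWeight       ≡⟨ fullSum-symmetrise n edgeWeight byVertex split ⟩
  fullSum n byVertex +ℤ fullSum n byVertex  ≡⟨ cong₂ _+ℤ_ byVertex-sum byVertex-sum ⟩
  S +ℤ S                     ∎)
  where
  open ≡-Reasoning
  edgeWeight : Fin n → Fin n → ℤ
  edgeWeight = onEdges G (λ u v → a u +ℤ a v)

  byVertex : Fin n → Fin n → ℤ
  byVertex = onEdges G (λ u _ → a u)

  E S : ℤ
  E = edgeSumℤ G (λ u v → a u +ℤ a v)
  S = sumℤ n (λ u → a u *ℤ + deg G u)

  byVertex-sum : fullSum n byVertex ≡ S
  byVertex-sum = sum-cong n (λ u → neighbourSum G (a u) u)

  edgeWeight-sym : ∀ u v → edgeWeight u v ≡ edgeWeight v u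
  edgeWeight-sym u v rewrite Graph.sym G u v with adj G v u
  ... | true  = ℤP.+-comm (a u) (a v)
  ... | false = refl

  edgeWeight-diag : ∀ u → edgeWeight u u ≡ + 0
  edgeWeight-diag u rewrite irrefl G u = refl

  split : ∀ u v → edgeWeight u v ≡ byVertex u v +ℤ byVertex v u
  split u v rewrite Graph.sym G v u with adj G u v
  ... | true  = refl
  ... | false = refl

square-nonneg : ∀ (x : ℤ) → + 0 ≤ x *ℤ x
square-nonneg (+ k)    = subst (+ 0 ≤_) (ℤP.pos-* k k) (+≤+ ℕ.z≤n)
square-nonneg -[1+ k ] = +≤+ ℕ.z≤n

-- 4 (n - x) x ≤ n², since the difference is the square (n - 2x)².
four-times-product≤square : ∀ (m x : ℤ) → + 4 *ℤ ((m - x) *ℤ x) ≤ m *ℤ m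
four-times-product≤square m x = begin
  + 4 *ℤ ((m - x) *ℤ x)                                ≡⟨ ≡-sym (ℤP.+-identityʳ _) ⟩
  + 4 *ℤ ((m - x) *ℤ x) +ℤ + 0
    ≤⟨ ℤP.+-monoʳ-≤ (+ 4 *ℤ ((m - x) *ℤ x)) (square-nonneg (m - x - x)) ⟩
  + 4 *ℤ ((m - x) *ℤ x) +ℤ (m - x - x) *ℤ (m - x - x)  ≡⟨ completeSquare m x ⟩
  m *ℤ m                                               ∎
  where
  open ℤP.≤-Reasoning
  completeSquare : ∀ m x → + 4 *ℤ ((m - x) *ℤ x) +ℤ (m - x - x) *ℤ (m - x - x) ≡ m *ℤ m
  completeSquare = solve-∀

≤-quarter : ∀ (y : ℤ) (m : ℕ) → + 4 *ℤ y ≤ + m → y ≤ + (m / 4)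
≤-quarter -[1+ k ] m _  = -≤+
≤-quarter (+ k)    m 4k≤m = +≤+ (begin
  k              ≡⟨ ≡-sym (ℕD.m*n/n≡m k 4) ⟩
  (k * 4) / 4    ≤⟨ ℕD./-monoˡ-≤ 4 k*4≤m ⟩
  m / 4          ∎)
  where
  open ℕP.≤-Reasoning
  k*4≤m : k * 4 ℕ.≤ m
  k*4≤m = subst (ℕ._≤ m) (ℕP.*-comm 4 k) (ℤP.drop‿+≤+ (subst (_≤ + m) (≡-sym (ℤP.pos-* 4 k)) 4k≤m))

product≤quarterSquare : ∀ (n : ℕ) (x : ℤ) → (+ n - x) *ℤ x ≤ + ((n * n) / 4)
product≤quarterSquare n x = ≤-quarter _ (n * n)
  (subst (+ 4 *ℤ ((+ n - x) *ℤ x) ≤_) (≡-sym (ℤP.pos-* n n)) (four-times-product≤square (+ n) x))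

twiceGap-split : ∀ {n} (G : Graph n) (u v : Fin n) →
  twiceGap G u v ≡ (+ n - + deg G u) +ℤ (+ n - + deg G v)
twiceGap-split {n} G u v = trans
  (cong (λ z → z - + deg G u - + deg G v) (ℤP.pos-* 2 n))
  (regroup (+ n) (+ deg G u) (+ deg G v))
  where
  regroup : ∀ m a b → + 2 *ℤ m - a - b ≡ (m - a) +ℤ (m - b)
  regroup = solve-∀

proposition23 : (n : ℕ) (G : Graph n) →
    edgeSumℤ G (twiceGap G) ≤ + (n * ((n * n) / 4))
proposition23 n G = begin
  edgeSumℤ G (twiceGap G)                  ≡⟨ edgeSum-cong G (twiceGap-split G) ⟩
  edgeSumℤ G (λ u v → gap u +ℤ gap v)      ≡⟨ edgeSum-vertexWeights G gap ⟩
  sumℤ n (λ u → gap u *ℤ + deg G u)        ≤⟨ sum-mono-≤ n (λ u → product≤quarterSquare n (+ deg G u)) ⟩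
  sumℤ n (λ _ → + ((n * n) / 4))           ≡⟨ sum-pos n (λ _ → (n * n) / 4) ⟩
  + sumℕ n (λ _ → (n * n) / 4)             ≡⟨ cong +_ (sumℕ-const n _) ⟩
  + (n * ((n * n) / 4))                    ∎
  where
  open ℤP.≤-Reasoning
  gap : Fin n → ℤ
  gap u = + n - + deg G u
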